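{- The only solutions of the equation $2^y(2^x+1)^z-1=(2^{x+1}+1)^w$ in integers $x\ge3$, $y\ge1$, $z\ge0$, $w\ge0$ are $(x,y,z,w)\in\{(x,1,0,0),(x,1,1,1)\}$ (with $x\ge3$ arbitrary). -}

module Defs where

{-# OPTIONS --safe #-}
-- Put a = 2^x + 1 = 2h + 1 and b = 2^(x+1) + 1 = 4h + 1 = 2a - 1, so that the equation reads
-- b^w + 1 = 2^y a^z.  As b ≡ 1 (mod 4) the left side is 2 (mod 4), which forces y = 1.
-- When z, w ≥ 1, b ≡ -1 (mod a) forces w to be odd (otherwise a ∣ 2), and then d = -b = 1 + a·(-2)
-- satisfies a^z ∣ d^w - 1.  Lifting the exponent for the odd modulus a, where -2 is a unit,
-- gives a^(z-1) ∣ w, whereas comparing sizes gives w ≤ z; since a ≥ 3 this leaves z = w = 1.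
module Submission where

module Congruences where
  open import Data.Nat.Base as ℕ using (ℕ; zero; suc)
  import Data.Nat.Properties as ℕ
  import Data.Nat.Divisibility as ℕ
  import Data.Nat.Tactic.RingSolver as ℕ
  open import Data.Nat.Coprimality
    using (Coprime; coprime-divisor; coprime-+; 1-coprimeTo; 0-coprimeTo-m⇒m≡1)
  open import Data.Nat.Combinatorics using (_C_; nC1≡n; nCk+nC[k+1]≡[n+1]C[k+1])
  open import Data.Integer.Base using (ℤ; +_; _+_; _-_; _*_; -_; _^_; 0ℤ; 1ℤ; ≢-nonZero)
  open import Data.Integer.Properties
    using (pos-*; +-injective; *-comm; *-identityʳ; i^n≡0⇒i≡0; ^-*-assoc;
           neg-distribˡ-*; neg-distribʳ-*; neg-involutive)
  open import Data.Integer.Divisibility.Signed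
  import Data.Integer.Coprimality as ℤ
  open import Data.Integer.Tactic.RingSolver using (solve-∀)
  open import Data.Empty using (⊥-elim)
  open import Data.Sum using (_⊎_; inj₁; inj₂; [_,_]′)
  open import Relation.Nullary.Negation using (¬_)
  open import Relation.Binary.PropositionalEquality

  [n+1]C2≡nC2+n : ∀ n → suc n C 2 ≡ n C 2 ℕ.+ n
  [n+1]C2≡nC2+n n = begin
    suc n C 2         ≡⟨ nCk+nC[k+1]≡[n+1]C[k+1] n 1 ⟨
    n C 1 ℕ.+ n C 2   ≡⟨ cong (ℕ._+ n C 2) (nC1≡n n) ⟩
    n ℕ.+ n C 2       ≡⟨ ℕ.+-comm n (n C 2) ⟩
    n C 2 ℕ.+ n       ∎
    where open ≡-Reasoning

  2*nC2≡n*[n-1] : ∀ n → 2 ℕ.* (n C 2) ≡ n ℕ.* ℕ.pred n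
  2*nC2≡n*[n-1] zero          = refl
  2*nC2≡n*[n-1] (suc zero)    = refl
  2*nC2≡n*[n-1] (suc (suc n)) = begin
    2 ℕ.* (suc (suc n) C 2)              ≡⟨ cong (2 ℕ.*_) ([n+1]C2≡nC2+n (suc n)) ⟩
    2 ℕ.* (suc n C 2 ℕ.+ suc n)          ≡⟨ ℕ.*-distribˡ-+ 2 (suc n C 2) (suc n) ⟩
    2 ℕ.* (suc n C 2) ℕ.+ 2 ℕ.* suc n    ≡⟨ cong (ℕ._+ 2 ℕ.* suc n) (2*nC2≡n*[n-1] (suc n)) ⟩
    suc n ℕ.* n ℕ.+ 2 ℕ.* suc n          ≡⟨ collect n ⟩
    suc (suc n) ℕ.* suc n                ∎
    where
    open ≡-Reasoning
    collect : ∀ n → suc n ℕ.* n ℕ.+ 2 ℕ.* suc n ≡ suc (suc n) ℕ.* suc n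
    collect = ℕ.solve-∀

  2h+1-coprimeTo-2 : ∀ h → Coprime (2 ℕ.* h ℕ.+ 1) 2
  2h+1-coprimeTo-2 zero    = 1-coprimeTo 2
  2h+1-coprimeTo-2 (suc h) =
    subst (λ n → Coprime (n ℕ.+ 1) 2) (sym (ℕ.*-suc 2 h)) (coprime-+ (2h+1-coprimeTo-2 h))

  3≤2h+1 : ∀ {h} → 1 ℕ.≤ h → 3 ℕ.≤ 2 ℕ.* h ℕ.+ 1
  3≤2h+1 1≤h = ℕ.+-monoˡ-≤ 1 (ℕ.*-monoʳ-≤ 2 1≤h)

  *-pres-∣ : ∀ {i j m n} → i ∣ m → j ∣ n → i * j ∣ m * n
  *-pres-∣ {i} {j} (divides q refl) (divides r refl) = divides (q * r) (interchange q i r j)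
    where
    interchange : ∀ q i r j → q * i * (r * j) ≡ q * r * (i * j)
    interchange = solve-∀

  ^-monoʳ-∣ : ∀ i {m n} → m ℕ.≤ n → i ^ m ∣ i ^ n
  ^-monoʳ-∣ i {n = n} ℕ.z≤n       = divides (i ^ n) (sym (*-identityʳ (i ^ n)))
  ^-monoʳ-∣ i         (ℕ.s≤s m≤n) = *-monoʳ-∣ i (^-monoʳ-∣ i m≤n)

  pos-^ : ∀ m n → + (m ℕ.^ n) ≡ (+ m) ^ n
  pos-^ m zero    = refl
  pos-^ m (suc n) = trans (pos-* m (m ℕ.^ n)) (cong (+ m *_) (pos-^ m n))

  [-i]^n≡i^n⊎-i^n : ∀ i n → (- i) ^ n ≡ i ^ n ⊎ (- i) ^ n ≡ - (i ^ n)
  [-i]^n≡i^n⊎-i^n i zero    = inj₁ refl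
  [-i]^n≡i^n⊎-i^n i (suc n) with [-i]^n≡i^n⊎-i^n i n
  ... | inj₁ even = inj₂ (trans (cong (- i *_) even) (sym (neg-distribˡ-* i (i ^ n))))
  ... | inj₂ odd  = inj₁ (begin
    - i * (- i) ^ n     ≡⟨ cong (- i *_) odd ⟩
    - i * - (i ^ n)     ≡⟨ neg-distribʳ-* (- i) (i ^ n) ⟨
    - (- i * i ^ n)     ≡⟨ cong -_ (neg-distribˡ-* i (i ^ n)) ⟨
    - - (i * i ^ n)     ≡⟨ neg-involutive (i * i ^ n) ⟩
    i * i ^ n           ∎)
    where open ≡-Reasoning

  ∣x-1⇒∣x^n-1 : ∀ {m x} n → m ∣ x - 1ℤ → m ∣ x ^ n - 1ℤ
  ∣x-1⇒∣x^n-1         zero    _     = divides 0ℤ refl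
  ∣x-1⇒∣x^n-1 {m} {x} (suc n) m∣x-1 =
    subst (m ∣_) (split x (x ^ n)) (∣m∣n⇒∣m+n (∣n⇒∣m*n x (∣x-1⇒∣x^n-1 n m∣x-1)) m∣x-1)
    where
    split : ∀ x X → x * (X - 1ℤ) + (x - 1ℤ) ≡ x * X - 1ℤ
    split = solve-∀

  binomial-mod-cube : ∀ x n → let t = x - 1ℤ in
    t * t * t ∣ x ^ n - (1ℤ + + n * t + + (n C 2) * (t * t))
  binomial-mod-cube x zero    = divides 0ℤ (vanish x)
    where
    vanish : ∀ x → let t = x - 1ℤ in 1ℤ - (1ℤ + + 0 * t + + 0 * (t * t)) ≡ 0ℤ * (t * t * t)
    vanish = solve-∀
  binomial-mod-cube x (suc n) =
    subst (λ c → t * t * t ∣ x ^ suc n - (1ℤ + + suc n * t + c * (t * t)))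
      (cong +_ (sym ([n+1]C2≡nC2+n n)))
      (subst (t * t * t ∣_) (split x (x ^ n) (+ n) (+ (n C 2)))
        (∣m∣n⇒∣m+n (∣n⇒∣m*n x (binomial-mod-cube x n)) (∣n⇒∣m*n (+ (n C 2)) ∣-refl)))
    where
    t = x - 1ℤ
    split : ∀ x X n c → let t = x - 1ℤ in
      x * (X - (1ℤ + n * t + c * (t * t))) + c * (t * t * t)
        ≡ x * X - (1ℤ + (1ℤ + n) * t + (c + n) * (t * t))
    split = solve-∀

  binomial-mod-square : ∀ x n → let t = x - 1ℤ in t * t ∣ x ^ n - (1ℤ + + n * t)
  binomial-mod-square x n = subst (t * t ∣_) (split x (x ^ n) (+ n) (+ (n C 2)))
    (∣m∣n⇒∣m+n (∣-trans (∣m⇒∣m*n t ∣-refl) (binomial-mod-cube x n)) (∣n⇒∣m*n (+ (n C 2)) ∣-refl))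
    where
    t = x - 1ℤ
    split : ∀ x X n c → let t = x - 1ℤ in
      X - (1ℤ + n * t + c * (t * t)) + c * (t * t) ≡ X - (1ℤ + n * t)
    split = solve-∀

  module _ {a : ℕ} (a-odd : Coprime a 2) where

    private
      A : ℤ
      A = + a

      A∣aC2 : A ∣ + (a C 2)
      A∣aC2 = ∣ᵤ⇒∣ (coprime-divisor a-odd
        (ℕ.divides (ℕ.pred a) (trans (2*nC2≡n*[n-1] a) (ℕ.*-comm a (ℕ.pred a)))))

      A^n≢0 : ∀ n → A ^ n ≢ 0ℤ
      A^n≢0 n A^n≡0 with +-injective (i^n≡0⇒i≡0 A n A^n≡0)
      ... | refl with 0-coprimeTo-m⇒m≡1 a-odd
      ... | ()

    module _ (k : ℕ) {d u : ℤ} (d≡ : A ^ (2 ℕ.+ k) ∣ d - (1ℤ + A ^ (1 ℕ.+ k) * u)) where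

      private
        P t : ℤ
        P = A ^ (1 ℕ.+ k)
        t = d - 1ℤ

        P∣t : P ∣ t
        P∣t = subst (P ∣_) (split d P u)
          (∣m∣n⇒∣m+n (∣-trans (∣n⇒∣m*n A (∣-refl {P})) d≡) (∣m⇒∣m*n u ∣-refl))
          where
          split : ∀ d P u → d - (1ℤ + P * u) + P * u ≡ d - 1ℤ
          split = solve-∀

        A∣t : A ∣ t
        A∣t = ∣-trans (∣m⇒∣m*n (A ^ k) ∣-refl) P∣t

        AP∣t² : A * P ∣ t * t
        AP∣t² = *-pres-∣ A∣t P∣t

      d^w≡1+A^[1+k]uw : ∀ w → A ^ (2 ℕ.+ k) ∣ d ^ w - (1ℤ + A ^ (1 ℕ.+ k) * (u * + w))
      d^w≡1+A^[1+k]uw w = subst (A * P ∣_) (split d (d ^ w) P u (+ w))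
        (∣m∣n⇒∣m+n (∣-trans AP∣t² (binomial-mod-square d w)) (∣n⇒∣m*n (+ w) d≡))
        where
        split : ∀ d D P u w →
          D - (1ℤ + w * (d - 1ℤ)) + w * (d - (1ℤ + P * u)) ≡ D - (1ℤ + P * (u * w))
        split = solve-∀

      -- Oddness of a enters here: a ∣ a C 2, so the quadratic term of the binomial
      -- expansion of (1 + t)^a vanishes modulo A^(3+k).
      d^a≡1+A^[2+k]u : A ^ (3 ℕ.+ k) ∣ d ^ a - (1ℤ + A ^ (2 ℕ.+ k) * u)
      d^a≡1+A^[2+k]u = subst (A * (A * P) ∣_) (split d (d ^ a) A P u (+ (a C 2)))
        (∣m∣n⇒∣m+n
          (∣m∣n⇒∣m+n
            (∣-trans (subst (_∣ t * t * t) (*-comm (A * P) A) (*-pres-∣ AP∣t² A∣t))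
                     (binomial-mod-cube d a))
            (*-monoʳ-∣ A d≡))
          (*-pres-∣ A∣aC2 AP∣t²))
        where
        split : ∀ d D A P u c → let t = d - 1ℤ in
          D - (1ℤ + A * t + c * (t * t)) + A * (d - (1ℤ + P * u)) + c * (t * t)
            ≡ D - (1ℤ + A * P * u)
        split = solve-∀

    lifting-the-exponent : ∀ k j {d u} w → ℤ.Coprime A u →
      A ^ (2 ℕ.+ k) ∣ d - (1ℤ + A ^ (1 ℕ.+ k) * u) →
      A ^ (1 ℕ.+ k ℕ.+ j) ∣ d ^ w - 1ℤ → a ℕ.^ j ℕ.∣ w
    lifting-the-exponent k zero    w _ _ _ = ℕ.1∣ w
    lifting-the-exponent k (suc j) {d} {u} w A⊥u d≡ A^[1+k+1+j]∣d^w-1 = a^[1+j]∣w a∣w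
      where
      P : ℤ
      P = A ^ (1 ℕ.+ k)

      A^[2+k+j]∣d^w-1 : A ^ (2 ℕ.+ k ℕ.+ j) ∣ d ^ w - 1ℤ
      A^[2+k+j]∣d^w-1 = subst (λ e → A ^ e ∣ d ^ w - 1ℤ) (ℕ.+-suc (1 ℕ.+ k) j) A^[1+k+1+j]∣d^w-1

      AP∣Puw : A * P ∣ P * (u * + w)
      AP∣Puw = subst (A * P ∣_) (difference (d ^ w) P (u * + w))
        (∣m∣n⇒∣m-n (∣-trans (^-monoʳ-∣ A (ℕ.m≤m+n (2 ℕ.+ k) j)) A^[2+k+j]∣d^w-1)
                   (d^w≡1+A^[1+k]uw k d≡ w))
        where
        difference : ∀ D P X → D - 1ℤ - (D - (1ℤ + P * X)) ≡ P * X
        difference = solve-∀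

      a∣w : a ℕ.∣ w
      a∣w = ℤ.coprime-divisor A u (+ w) A⊥u
        (∣⇒∣ᵤ (*-cancelˡ-∣ P (subst (_∣ P * (u * + w)) (*-comm A P) AP∣Puw)))
        where instance _ = ≢-nonZero (A^n≢0 (1 ℕ.+ k))

      a^[1+j]∣w : a ℕ.∣ w → a ℕ.^ suc j ℕ.∣ w
      a^[1+j]∣w (ℕ.divides w′ refl) = subst (a ℕ.^ suc j ℕ.∣_) (ℕ.*-comm a w′)
        (ℕ.*-monoʳ-∣ a (lifting-the-exponent (suc k) j w′ A⊥u (d^a≡1+A^[2+k]u k d≡)
          (subst (λ D → A ^ (2 ℕ.+ k ℕ.+ j) ∣ D - 1ℤ) (sym (^-*-assoc d a w′))
            (subst (λ e → A ^ (2 ℕ.+ k ℕ.+ j) ∣ d ^ e - 1ℤ) (ℕ.*-comm w′ a) A^[2+k+j]∣d^w-1))))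

  module _ (h : ℕ) where

    private
      a b : ℕ
      a = 2 ℕ.* h ℕ.+ 1
      b = 4 ℕ.* h ℕ.+ 1

      A B : ℤ
      A = + a
      B = + b

      A≡2h+1 : A ≡ + 2 * + h + 1ℤ
      A≡2h+1 = cong (_+ 1ℤ) (pos-* 2 h)

      B≡4h+1 : B ≡ + 4 * + h + 1ℤ
      B≡4h+1 = cong (_+ 1ℤ) (pos-* 4 h)

      [X+1]-[X-1]≡2 : ∀ X → X + 1ℤ - (X - 1ℤ) ≡ + 2
      [X+1]-[X-1]≡2 = solve-∀

      4≰2 : ¬ 4 ℕ.≤ 2
      4≰2 (ℕ.s≤s (ℕ.s≤s ()))

      d : ℤ
      d = 1ℤ + A * - + 2

      d≡-B : d ≡ - B
      d≡-B = begin
        1ℤ + A * - + 2                   ≡⟨ cong (λ A → 1ℤ + A * - + 2) A≡2h+1 ⟩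
        1ℤ + (+ 2 * + h + 1ℤ) * - + 2    ≡⟨ negate (+ h) ⟩
        - (+ 4 * + h + 1ℤ)               ≡⟨ cong -_ B≡4h+1 ⟨
        - B                              ∎
        where
        open ≡-Reasoning
        negate : ∀ H → 1ℤ + (+ 2 * H + 1ℤ) * - + 2 ≡ - (+ 4 * H + 1ℤ)
        negate = solve-∀

      A∣d^w-1 : ∀ w → A ∣ d ^ w - 1ℤ
      A∣d^w-1 w = ∣x-1⇒∣x^n-1 w (divides (- + 2) (cancel A (- + 2)))
        where
        cancel : ∀ A u → 1ℤ + A * u - 1ℤ ≡ u * A
        cancel = solve-∀

    y≡1 : ∀ {y z w} → 1 ℕ.≤ y → b ℕ.^ w ℕ.+ 1 ≡ 2 ℕ.^ y ℕ.* a ℕ.^ z → y ≡ 1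
    y≡1 {suc zero}            _ _  = refl
    y≡1 {suc (suc y)} {z} {w} _ eq = ⊥-elim (4≰2 (ℕ.∣⇒≤ (∣⇒∣ᵤ 4∣2)))
      where
      4∣b^w+1 : 4 ℕ.∣ b ℕ.^ w ℕ.+ 1
      4∣b^w+1 = subst (4 ℕ.∣_) (sym eq)
        (ℕ.∣m⇒∣m*n (a ℕ.^ z) (subst (4 ℕ.∣_) (ℕ.*-assoc 2 2 (2 ℕ.^ y)) (ℕ.m∣m*n (2 ℕ.^ y))))

      4∣B-1 : + 4 ∣ B - 1ℤ
      4∣B-1 = divides (+ h) (trans (cong (_- 1ℤ) B≡4h+1) (quarter (+ h)))
        where
        quarter : ∀ H → + 4 * H + 1ℤ - 1ℤ ≡ H * + 4
        quarter = solve-∀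

      4∣2 : + 4 ∣ + 2
      4∣2 = subst (+ 4 ∣_) ([X+1]-[X-1]≡2 (B ^ w))
        (∣m∣n⇒∣m-n (subst (+ 4 ∣_) (cong (_+ 1ℤ) (pos-^ b w)) (∣ᵤ⇒∣ 4∣b^w+1))
                   (∣x-1⇒∣x^n-1 w 4∣B-1))

    a^z∣w : 1 ℕ.≤ h → ∀ z w → 2 ℕ.* a ℕ.^ suc z ≡ b ℕ.^ w ℕ.+ 1 → a ℕ.^ z ℕ.∣ w
    a^z∣w 1≤h z w eq = [ even , odd ]′ ([-i]^n≡i^n⊎-i^n B w)
      where
      open ≡-Reasoning

      2A^[1+z]≡B^w+1 : + 2 * A ^ suc z ≡ B ^ w + 1ℤ
      2A^[1+z]≡B^w+1 = begin
        + 2 * A ^ suc z            ≡⟨ cong (+ 2 *_) (pos-^ a (suc z)) ⟨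
        + 2 * + (a ℕ.^ suc z)      ≡⟨ pos-* 2 (a ℕ.^ suc z) ⟨
        + (2 ℕ.* a ℕ.^ suc z)      ≡⟨ cong +_ eq ⟩
        + (b ℕ.^ w) + 1ℤ           ≡⟨ cong (_+ 1ℤ) (pos-^ b w) ⟩
        B ^ w + 1ℤ                 ∎

      even : (- B) ^ w ≡ B ^ w → a ℕ.^ z ℕ.∣ w
      even [-B]^w≡B^w = ⊥-elim (ℕ.<⇒≱ (3≤2h+1 1≤h) (ℕ.∣⇒≤ (∣⇒∣ᵤ A∣2)))
        where
        A∣2 : A ∣ + 2
        A∣2 = subst (A ∣_) ([X+1]-[X-1]≡2 (B ^ w))
          (∣m∣n⇒∣m-n (subst (A ∣_) 2A^[1+z]≡B^w+1 (∣n⇒∣m*n (+ 2) (∣m⇒∣m*n (A ^ z) ∣-refl)))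
                     (subst (λ x → A ∣ x - 1ℤ) (trans (cong (_^ w) d≡-B) [-B]^w≡B^w) (A∣d^w-1 w)))

      -- The coprimality of A and -2 over ℤ is, by definition, that of a and 2 over ℕ.
      odd : (- B) ^ w ≡ - (B ^ w) → a ℕ.^ z ℕ.∣ w
      odd [-B]^w≡-B^w = lifting-the-exponent (2h+1-coprimeTo-2 h) 0 z w (2h+1-coprimeTo-2 h)
        (divides 0ℤ (vanish A (A ^ 2)))
        (divides (- + 2) (begin
          d ^ w - 1ℤ                ≡⟨ cong (λ x → x ^ w - 1ℤ) d≡-B ⟩
          (- B) ^ w - 1ℤ            ≡⟨ cong (_- 1ℤ) [-B]^w≡-B^w ⟩
          - (B ^ w) - 1ℤ            ≡⟨ negate (B ^ w) ⟩
          - (B ^ w + 1ℤ)            ≡⟨ cong -_ 2A^[1+z]≡B^w+1 ⟨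
          - (+ 2 * A ^ suc z)       ≡⟨ neg-distribˡ-* (+ 2) (A ^ suc z) ⟩
          - + 2 * A ^ suc z         ∎))
        where
        vanish : ∀ A X → 1ℤ + A * - + 2 - (1ℤ + A * 1ℤ * - + 2) ≡ 0ℤ * X
        vanish = solve-∀
        negate : ∀ X → - X - 1ℤ ≡ - (X + 1ℤ)
        negate = solve-∀

open import Defs
open import Data.Nat using (ℕ; _+_; _*_; _∸_; _^_; _≤_)
open import Data.Product using (_×_)
open import Data.Sum using (_⊎_)
open import Relation.Binary.PropositionalEquality using (_≡_)

open import Data.Nat using (zero; suc; _<_; s≤s; z≤n; z<s; >-nonZero)
open import Data.Nat.Properties
open import Data.Nat.Divisibility using (∣⇒≤)
open import Data.Nat.Tactic.RingSolver using (solve-∀)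
open import Data.Empty using (⊥-elim)
open import Data.Product using (_,_)
open import Data.Sum using (inj₁; inj₂)
open import Relation.Binary.PropositionalEquality using (refl; sym; trans; cong; module ≡-Reasoning)
open Congruences using (3≤2h+1; y≡1; a^z∣w)

Solution : ℕ → ℕ → ℕ → Set
Solution y z w = (y ≡ 1 × z ≡ 0 × w ≡ 0) ⊎ (y ≡ 1 × z ≡ 1 × w ≡ 1)

w≤z : ∀ {a b z w} → a ≤ b → 2 ≤ b → 2 * a ^ z ≡ b ^ w + 1 → w ≤ z
w≤z {a} {b} {z} {w} a≤b 2≤b eq = ≮⇒≥ λ z<w → <-irrefl refl (begin-strict
  b ^ w        <⟨ m<m+n (b ^ w) z<s ⟩
  b ^ w + 1    ≡⟨ eq ⟨
  2 * a ^ z    ≤⟨ *-monoˡ-≤ (a ^ z) 2≤b ⟩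
  b * a ^ z    ≤⟨ *-monoʳ-≤ b (^-monoˡ-≤ z a≤b) ⟩
  b * b ^ z    ≤⟨ ^-monoʳ-≤ b z<w ⟩
  b ^ w        ∎)
  where
  open ≤-Reasoning
  instance _ = >-nonZero (≤-trans (s≤s z≤n) 2≤b)

2+n<a^[1+n] : ∀ {a} → 3 ≤ a → ∀ n → 2 + n < a ^ (1 + n)
2+n<a^[1+n] {a} 3≤a zero    = ≤-trans 3≤a (≤-reflexive (sym (*-identityʳ a)))
2+n<a^[1+n] {a} 3≤a (suc n) = begin-strict
  3 + n          ≤⟨ 2+n<a^[1+n] 3≤a n ⟩
  X              <⟨ m<m+n X (≤-trans (s≤s z≤n) (2+n<a^[1+n] 3≤a n)) ⟩
  X + X          ≡⟨ cong (X +_) (+-identityʳ X) ⟨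
  2 * X          ≤⟨ *-monoˡ-≤ X (≤-trans (s≤s (s≤s z≤n)) 3≤a) ⟩
  a ^ (2 + n)    ∎
  where
  open ≤-Reasoning
  X = a ^ (1 + n)

module _ {h : ℕ} (1≤h : 1 ≤ h) where

  private
    a b : ℕ
    a = 2 * h + 1
    b = 4 * h + 1

    3≤a : 3 ≤ a
    3≤a = 3≤2h+1 1≤h

    1<a : 1 < a
    1<a = ≤-trans (s≤s (s≤s z≤n)) 3≤a

    a≤b : a ≤ b
    a≤b = +-monoˡ-≤ 1 (*-monoˡ-≤ h (m≤m+n 2 2))

  solutions-y≡1 : ∀ z w → 2 * a ^ z ≡ b ^ w + 1 → Solution 1 z w
  solutions-y≡1 zero    zero    _  = inj₁ (refl , refl , refl)
  solutions-y≡1 zero    (suc w) eq with m^n≡1⇒n≡0∨m≡1 b (suc w) (sym (+-cancelʳ-≡ 1 1 _ eq))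
  ... | inj₂ b≡1 = ⊥-elim (<-irrefl (sym b≡1) (≤-trans 1<a a≤b))
  solutions-y≡1 (suc z) zero    eq with m^n≡1⇒n≡0∨m≡1 a (suc z) (*-cancelˡ-≡ _ 1 2 eq)
  ... | inj₂ a≡1 = ⊥-elim (<-irrefl (sym a≡1) 1<a)
  solutions-y≡1 (suc z) (suc w) eq =
    squeeze z (w≤z a≤b (≤-trans 1<a a≤b) eq) (∣⇒≤ (a^z∣w h 1≤h z (suc w) eq))
    where
    squeeze : ∀ z → suc w ≤ suc z → a ^ z ≤ suc w → Solution 1 (suc z) (suc w)
    squeeze zero    (s≤s w≤0) _ rewrite n≤0⇒n≡0 w≤0 = inj₂ (refl , refl , refl)
    squeeze (suc z) w≤z       a^z≤w = ⊥-elim (<⇒≱ (2+n<a^[1+n] 3≤a z) (≤-trans a^z≤w w≤z))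

  solutions : ∀ {y z w} → 1 ≤ y → b ^ w + 1 ≡ 2 ^ y * a ^ z → Solution y z w
  solutions {y} {z} {w} 1≤y eq with y≡1 h {y} {z} {w} 1≤y eq
  ... | refl = solutions-y≡1 z w (sym eq)

lemma2 : (x y z w : ℕ) → 3 ≤ x → 1 ≤ y →
    ((2 ^ y * (2 ^ x + 1) ^ z ∸ 1 ≡ (2 ^ (x + 1) + 1) ^ w) →
    ((y ≡ 1 × z ≡ 0 × w ≡ 0) ⊎ (y ≡ 1 × z ≡ 1 × w ≡ 1)))
    × (((y ≡ 1 × z ≡ 0 × w ≡ 0) ⊎ (y ≡ 1 × z ≡ 1 × w ≡ 1)) →
    2 ^ y * (2 ^ x + 1) ^ z ∸ 1 ≡ (2 ^ (x + 1) + 1) ^ w)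
lemma2 (suc x) y z w _ 1≤y = forward , backward
  where
  open ≡-Reasoning

  h : ℕ
  h = 2 ^ x

  2^[x+2]+1≡4h+1 : 2 ^ (suc x + 1) + 1 ≡ 4 * h + 1
  2^[x+2]+1≡4h+1 = trans (cong (λ e → 2 * 2 ^ e + 1) (+-comm x 1)) (cong (_+ 1) (sym (*-assoc 2 2 h)))

  1≤2^y*a^z : 1 ≤ 2 ^ y * (2 * h + 1) ^ z
  1≤2^y*a^z = *-mono-≤ (m^n>0 2 y) (m^n>0 (2 * h + 1) z)
    where instance _ = >-nonZero (m≤n+m 1 (2 * h))

  forward : 2 ^ y * (2 * h + 1) ^ z ∸ 1 ≡ (2 ^ (suc x + 1) + 1) ^ w → Solution y z w
  forward eq = solutions (m^n>0 2 x) 1≤y (begin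
    (4 * h + 1) ^ w + 1                  ≡⟨ cong (λ b → b ^ w + 1) 2^[x+2]+1≡4h+1 ⟨
    (2 ^ (suc x + 1) + 1) ^ w + 1        ≡⟨ cong (_+ 1) eq ⟨
    2 ^ y * (2 * h + 1) ^ z ∸ 1 + 1      ≡⟨ m∸n+n≡m 1≤2^y*a^z ⟩
    2 ^ y * (2 * h + 1) ^ z              ∎)

  backward : Solution y z w → 2 ^ y * (2 * h + 1) ^ z ∸ 1 ≡ (2 ^ (suc x + 1) + 1) ^ w
  backward (inj₁ (refl , refl , refl)) = refl
  backward (inj₂ (refl , refl , refl)) =
    trans (cong (_∸ 1) (double h)) (cong (_* 1) (sym 2^[x+2]+1≡4h+1))
    where
    double : ∀ h → 2 * ((2 * h + 1) * 1) ≡ suc ((4 * h + 1) * 1)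
    double = solve-∀
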